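{- Let $G=(V_1\,\dot\cup\,V_2,E)$ be a connected bipartite graph with nonempty parts $V_1,V_2$ (every edge joins $V_1$ and $V_2$), and let $c$ be the valid $2$-colouring of $G$ whose colour classes are $V_1$ and $V_2$. Then $G$ is strictly $\min\{|V_1|,|V_2|\}$-local with respect to $c$, i.e. $\operatorname{loc}(G,c)=\min\{|V_1|,|V_2|\}$.
   Context: A colouring of $G=(V,E)$ is a function $c:V\to[\ell]$; valid means adjacent vertices get distinct colours. Let $\mathcal C(G,c)=c(V)$, $m=|\mathcal C(G,c)|$; a marking sequence is an enumeration $e=(x_1,\dots,x_m)$ of $\mathcal C(G,c)$; $G_i$ is the subgraph induced by the vertices with colours in $\{x_1,\dots,x_i\}$; with $\gamma(H)$ the number of connected components, $\operatorname{loc}(G,c,e)=\max_i\gamma(G_i)$ and $\operatorname{loc}(G,c)=\min_e\operatorname{loc}(G,c,e)$. $G$ is $k$-local if $\operatorname{loc}(G,c)\le k$, and strictly $k$-local if it is $k$-local but not $(k-1)$-local. -}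

module Defs where

open import Data.Nat using (ℕ; zero; suc; _≤_)
open import Data.Fin using (Fin; toℕ)
open import Data.Fin.Properties using (_≟_)
open import Data.List using (List; length; filter; allFin)
open import Data.Product using (Σ; ∃; ∃-syntax; _×_; _,_)
open import Data.Unit using (⊤)
open import Relation.Nullary using (¬_)
open import Relation.Binary.PropositionalEquality using (_≡_; _≢_)
open import Function.Definitions using (Injective)
open import Function.Bundles using (_⇔_)

record Graph (n : ℕ) : Set₁ where
  field
    Adj    : Fin n → Fin n → Set
    sym    : ∀ {v w} → Adj v w → Adj w v
    irrefl : ∀ {v} → ¬ Adj v v
open Graph public

VSet : ℕ → Set₁
VSet n = Fin n → Set

data Reach {n : ℕ} (G : Graph n) (S : VSet n) : Fin n → Fin n → Set where
  here : ∀ {v} → S v → Reach G S v v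
  step : ∀ {u v w} → S u → Adj G u v → Reach G S v w → Reach G S u w

Connected : ∀ {n} → Graph n → Set
Connected G = ∀ v w → Reach G (λ _ → ⊤) v w

-- γ(G[S]) = k : the components of G[S] are in bijection with Fin k,
-- i.e. there is a labelling f of the vertices of S, onto Fin k, such that
-- two vertices of S get the same label iff they are joined by a walk in G[S].
ComponentCount : ∀ {n} → Graph n → VSet n → ℕ → Set
ComponentCount {n} G S k =
  Σ (Fin n → Fin k) λ f →
    (∀ v w → S v → S w → (f v ≡ f w ⇔ Reach G S v w)) ×
    (∀ j → ∃[ v ] (S v × f v ≡ j))

Valid : ∀ {n ℓ} → Graph n → (Fin n → Fin ℓ) → Set
Valid G c = ∀ {v w} → Adj G v w → c v ≢ c w

record MarkingSeq {n ℓ : ℕ} (c : Fin n → Fin ℓ) : Set where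
  field
    m      : ℕ
    seq    : Fin m → Fin ℓ
    inj    : Injective _≡_ _≡_ seq
    inImg  : ∀ i → ∃[ v ] (c v ≡ seq i)
    covers : ∀ v → ∃[ i ] (seq i ≡ c v)
open MarkingSeq public

-- G_i for i : Fin m (standing for i+1 ∈ {1..m}): vertices whose colour
-- is among x_1,…,x_{i+1}.
Prefix : ∀ {n ℓ} {c : Fin n → Fin ℓ} (e : MarkingSeq c) → Fin (m e) → VSet n
Prefix {c = c} e i v = ∃[ j ] (toℕ j ≤ toℕ i × seq e j ≡ c v)

LocAtMost : ∀ {n ℓ} → Graph n → (c : Fin n → Fin ℓ) → MarkingSeq c → ℕ → Set
LocAtMost G c e k = ∀ i → ∃[ g ] (ComponentCount G (Prefix e i) g × g ≤ k)

Local : ∀ {n ℓ} → Graph n → (Fin n → Fin ℓ) → ℕ → Set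
Local G c k = ∃[ e ] LocAtMost G c e k

StrictlyLocal : ∀ {n ℓ} → Graph n → (Fin n → Fin ℓ) → ℕ → Set
StrictlyLocal G c k = Local G c k × (∀ j → suc j ≡ k → ¬ Local G c j)

classSize : ∀ {n ℓ} → (Fin n → Fin ℓ) → Fin ℓ → ℕ
classSize {n} c x = length (filter (λ v → c v ≟ x) (allFin n))

-- A colour class of a valid colouring is an independent set, so the subgraph
-- it induces has one component per vertex.  Every marking sequence begins
-- with a single colour class, which forces loc(G,c) ≥ min{|V₁|,|V₂|}.
-- Conversely, marking the smaller class first gives exactly that many
-- components, and marking the other class then yields the connected G.
{-# OPTIONS --safe #-}
module Submission where

open import Defs hiding (sym)
open import Data.Nat using (ℕ; zero; suc; _≤_; _⊓_; z≤n; s≤s)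
open import Data.Nat.Properties
  using (≤-refl; ≤-trans; ≤-reflexive; n≤0⇒n≡0; 1+n≰n; ⊓-sel; m⊓n≤m; m⊓n≤n)
open import Data.Fin using (Fin; zero; suc; toℕ)
open import Data.Fin.Properties using (_≟_; toℕ-injective; toℕ<n; toℕ≤pred[n]; injective⇒≤)
open import Data.Fin.Permutation using (Permutation′; _⟨$⟩ʳ_; _⟨$⟩ˡ_; inverseʳ; transpose)
open import Data.List using (List; length; filter; allFin; lookup)
import Data.List.Relation.Unary.All as All
open import Data.List.Relation.Unary.AllPairs using ([]; _∷_)
open import Data.List.Relation.Unary.Any using (index)
open import Data.List.Relation.Unary.Any.Properties using (lookup-index)
open import Data.List.Relation.Unary.Unique.Propositional using (Unique)
open import Data.List.Relation.Unary.Unique.Propositional.Properties using (filter⁺; allFin⁺)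
open import Data.List.Membership.Propositional using (_∈_)
open import Data.List.Membership.Propositional.Properties
  using (∈-filter⁺; ∈-filter⁻; ∈-allFin; ∈-lookup)
open import Data.Product using (Σ; ∃-syntax; _×_; _,_; proj₁; proj₂)
open import Data.Sum using (inj₁; inj₂)
open import Data.Empty using (⊥-elim)
open import Function.Bundles using (Injection; _⇔_; mk⇔; Equivalence)
open import Function.Properties.Inverse using (↔⇒↣)
open import Relation.Nullary using (¬_; yes; no)
open import Relation.Unary using (_⊆_; _≐_; Universal; Decidable)
open import Relation.Binary.PropositionalEquality using (_≡_; refl; sym; trans; cong; subst)

lookup-injective : ∀ {A : Set} {xs : List A} → Unique xs →
  ∀ {i j} → lookup xs i ≡ lookup xs j → i ≡ j
lookup-injective []           {()}
lookup-injective (_ ∷ _)      {zero}  {zero}  _  = refl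
lookup-injective (x∉ ∷ _)     {zero}  {suc j} eq = ⊥-elim (All.lookup x∉ (∈-lookup j) eq)
lookup-injective (x∉ ∷ _)     {suc i} {zero}  eq = ⊥-elim (All.lookup x∉ (∈-lookup i) (sym eq))
lookup-injective (_ ∷ uniq)   {suc i} {suc j} eq = cong suc (lookup-injective uniq eq)

Reach-source : ∀ {n} {G : Graph n} {S : VSet n} {v w} → Reach G S v w → S v
Reach-source (here sv)     = sv
Reach-source (step su _ _) = su

Reach-mono : ∀ {n} {G : Graph n} {S S′ : VSet n} → S ⊆ S′ →
  ∀ {v w} → Reach G S v w → Reach G S′ v w
Reach-mono S⊆S′ (here sv)       = here (S⊆S′ sv)
Reach-mono S⊆S′ (step su adj r) = step (S⊆S′ su) adj (Reach-mono S⊆S′ r)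

Independent : ∀ {n} → Graph n → VSet n → Set
Independent G S = ∀ {v w} → S v → S w → ¬ Adj G v w

Independent⇒Reach⇒≡ : ∀ {n} {G : Graph n} {S : VSet n} → Independent G S →
  ∀ {v w} → Reach G S v w → v ≡ w
Independent⇒Reach⇒≡ indep (here _)         = refl
Independent⇒Reach⇒≡ indep (step su adj r) = ⊥-elim (indep su (Reach-source r) adj)

colourClass : ∀ {n ℓ} → (Fin n → Fin ℓ) → Fin ℓ → VSet n
colourClass c x v = c v ≡ x

Valid⇒colourClass-independent : ∀ {n ℓ} {G : Graph n} {c : Fin n → Fin ℓ} →
  Valid G c → ∀ x → Independent G (colourClass c x)
Valid⇒colourClass-independent valid x cv≡x cw≡x adj = valid adj (trans cv≡x (sym cw≡x))

ComponentCount-resp-≐ : ∀ {n k} {G : Graph n} {S S′ : VSet n} →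
  S ≐ S′ → ComponentCount G S k → ComponentCount G S′ k
ComponentCount-resp-≐ {G = G} {S = S} {S′ = S′} (S⊆S′ , S′⊆S) (f , sameLabel⇔Reach , onto) =
  f , sameLabel⇔Reach′ , onto′
  where
  sameLabel⇔Reach′ : ∀ v w → S′ v → S′ w → (f v ≡ f w ⇔ Reach G S′ v w)
  sameLabel⇔Reach′ v w s′v s′w = mk⇔
    (λ fv≡fw → Reach-mono S⊆S′ (Equivalence.to (sameLabel⇔Reach v w (S′⊆S s′v) (S′⊆S s′w)) fv≡fw))
    (λ r → Equivalence.from (sameLabel⇔Reach v w (S′⊆S s′v) (S′⊆S s′w)) (Reach-mono S′⊆S r))
  onto′ : ∀ j → ∃[ v ] (S′ v × f v ≡ j)
  onto′ j = let (v , sv , fv≡j) = onto j in v , S⊆S′ sv , fv≡j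

ComponentCount-≤ : ∀ {n k k′} {G : Graph n} {S : VSet n} →
  ComponentCount G S k → ComponentCount G S k′ → k ≤ k′
ComponentCount-≤ {n} {k} {k′} (f , f-sound , f-onto) (f′ , f′-sound , _) =
  injective⇒≤ relabel-injective
  where
  representative : Fin k → Fin n
  representative j = proj₁ (f-onto j)

  relabel : Fin k → Fin k′
  relabel j = f′ (representative j)

  relabel-injective : ∀ {i j} → relabel i ≡ relabel j → i ≡ j
  relabel-injective {i} {j} eq =
    let (_ , si , fi≡i) = f-onto i
        (_ , sj , fj≡j) = f-onto j
        reach = Equivalence.to (f′-sound _ _ si sj) eq
    in trans (sym fi≡i) (trans (Equivalence.from (f-sound _ _ si sj) reach) fj≡j)

Connected⇒ComponentCount-1 : ∀ {n} {G : Graph n} {S : VSet n} →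
  Connected G → Fin n → Universal S → ComponentCount G S 1
Connected⇒ComponentCount-1 conn v₀ all =
  (λ _ → zero) ,
  (λ v w _ _ → mk⇔ (λ _ → Reach-mono (λ {u} _ → all u) (conn v w)) (λ _ → refl)) ,
  λ { zero → v₀ , all v₀ , refl }

ComponentCount-positive : ∀ {n k} {G : Graph n} {S : VSet n} →
  ComponentCount G S k → Fin n → 1 ≤ k
ComponentCount-positive (f , _) v = ≤-trans (s≤s z≤n) (toℕ<n (f v))

module _ {n} {S : VSet n} (S? : Decidable S) where

  private
    members : List (Fin n)
    members = filter S? (allFin n)

    ∈-members : ∀ {v} → S v → v ∈ members
    ∈-members {v} sv = ∈-filter⁺ S? (∈-allFin v) sv

    lookup-members : ∀ j → S (lookup members j)
    lookup-members j = proj₂ (∈-filter⁻ S? {xs = allFin n} (∈-lookup j))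

  Independent⇒ComponentCount-length : ∀ {G : Graph n} → Independent G S → ∀ {v₀} → S v₀ →
    ComponentCount G S (length (filter S? (allFin n)))
  Independent⇒ComponentCount-length {G = G} indep {v₀} sv₀ =
    label , sameLabel⇔Reach , label-onto
    where
    -- Vertices outside S get v₀'s label; a component labelling only matters on S.
    label : Fin n → Fin (length members)
    label v with S? v
    ... | yes sv = index (∈-members sv)
    ... | no _   = index (∈-members sv₀)

    lookup-label : ∀ {v} → S v → lookup members (label v) ≡ v
    lookup-label {v} sv with S? v
    ... | yes sv′ = sym (lookup-index (∈-members sv′))
    ... | no ¬sv  = ⊥-elim (¬sv sv)

    sameLabel⇔Reach : ∀ v w → S v → S w → (label v ≡ label w ⇔ Reach G S v w)
    sameLabel⇔Reach v w sv sw = mk⇔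
      (λ eq → subst (Reach G S v)
                (trans (sym (lookup-label sv)) (trans (cong (lookup members) eq) (lookup-label sw)))
                (here sv))
      (λ r → cong label (Independent⇒Reach⇒≡ indep r))

    label-onto : ∀ j → ∃[ v ] (S v × label v ≡ j)
    label-onto j =
      lookup members j , lookup-members j ,
      lookup-injective (filter⁺ S? (allFin⁺ n)) (lookup-label (lookup-members j))

markingSeq : ∀ {n ℓ} {c : Fin n → Fin ℓ} → Permutation′ ℓ →
  (∀ x → ∃[ v ] c v ≡ x) → MarkingSeq c
markingSeq {c = c} π onto = record
  { m      = _
  ; seq    = π ⟨$⟩ʳ_
  ; inj    = Injection.injective (↔⇒↣ π)
  ; inImg  = λ i → onto (π ⟨$⟩ʳ i)
  ; covers = λ v → π ⟨$⟩ˡ c v , inverseʳ π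
  }

module _ {n ℓ} {c : Fin n → Fin ℓ} (e : MarkingSeq c) where

  Prefix-initial : ∀ i → toℕ i ≡ 0 → colourClass c (seq e i) ≐ Prefix e i
  Prefix-initial i i≡0 = (λ cv≡x → i , ≤-refl , sym cv≡x) , earlier⇒same
    where
    earlier⇒same : Prefix e i ⊆ colourClass c (seq e i)
    earlier⇒same (j , j≤i , xj≡cv) =
      let j≡i = toℕ-injective (trans (n≤0⇒n≡0 (subst (toℕ j ≤_) i≡0 j≤i)) (sym i≡0))
      in trans (sym xj≡cv) (cong (seq e) j≡i)

  Prefix-final : ∀ i → (∀ j → toℕ j ≤ toℕ i) → Universal (Prefix e i)
  Prefix-final i last v = let (j , xj≡cv) = covers e v in j , last j , xj≡cv

initialIndex : ∀ {m} → Fin m → Σ (Fin m) λ i → toℕ i ≡ 0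
initialIndex zero    = zero , refl
initialIndex (suc _) = zero , refl

Valid⇒ComponentCount-classSize : ∀ {n ℓ} {G : Graph n} {c : Fin n → Fin ℓ} → Valid G c →
  ∀ {x v} → c v ≡ x → ComponentCount G (colourClass c x) (classSize c x)
Valid⇒ComponentCount-classSize {G = G} {c = c} valid {x} =
  Independent⇒ComponentCount-length (λ v → c v ≟ x)
    (Valid⇒colourClass-independent {G = G} valid x)

Local⇒classSize≤ : ∀ {n ℓ k} {G : Graph n} {c : Fin n → Fin ℓ} → Valid G c → Fin n →
  Local G c k → ∃[ x ] classSize c x ≤ k
Local⇒classSize≤ valid v₀ (e , locAtMost) =
  let (i , i≡0)         = initialIndex (proj₁ (covers e v₀))
      (g , count , g≤k) = locAtMost i
      classCount        = ComponentCount-resp-≐ (Prefix-initial e i i≡0)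
                            (Valid⇒ComponentCount-classSize valid (proj₂ (inImg e i)))
  in seq e i , ≤-trans (ComponentCount-≤ classCount count) g≤k

Local-classSize : ∀ {n} {G : Graph n} {c : Fin n → Fin 2} → Valid G c →
  (∀ x → ∃[ v ] c v ≡ x) → Connected G → ∀ x → Local G c (classSize c x)
Local-classSize {G = G} {c = c} valid onto conn x = e , locAtMost
  where
  -- Marks x first, then the other colour.
  e : MarkingSeq c
  e = markingSeq (transpose zero x) onto

  v₀ : Fin _
  v₀ = proj₁ (onto x)

  classCount : ComponentCount G (Prefix e zero) (classSize c x)
  classCount = ComponentCount-resp-≐ (Prefix-initial e zero refl)
                 (Valid⇒ComponentCount-classSize valid (proj₂ (onto x)))

  locAtMost : LocAtMost G c e (classSize c x)
  locAtMost zero       = classSize c x , classCount , ≤-refl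
  locAtMost (suc zero) =
    1 , Connected⇒ComponentCount-1 conn v₀ (Prefix-final e (suc zero) toℕ≤pred[n]) ,
    ComponentCount-positive classCount v₀

proposition16 : ∀ {n} (G : Graph n) (c : Fin n → Fin 2) →
    Valid G c →
    (∃[ v ] c v ≡ zero) → (∃[ v ] c v ≡ suc zero) →
    Connected G →
    StrictlyLocal G c (classSize c zero ⊓ classSize c (suc zero))
proposition16 G c valid used₀ used₁ conn = upper , lower
  where
  onto : ∀ x → ∃[ v ] c v ≡ x
  onto zero       = used₀
  onto (suc zero) = used₁

  minSize : ℕ
  minSize = classSize c zero ⊓ classSize c (suc zero)

  minSize≤classSize : ∀ x → minSize ≤ classSize c x
  minSize≤classSize zero       = m⊓n≤m _ _
  minSize≤classSize (suc zero) = m⊓n≤n _ _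

  upper : Local G c minSize
  upper with ⊓-sel (classSize c zero) (classSize c (suc zero))
  ... | inj₁ min≡size₀ = subst (Local G c) (sym min≡size₀) (Local-classSize valid onto conn zero)
  ... | inj₂ min≡size₁ =
    subst (Local G c) (sym min≡size₁) (Local-classSize valid onto conn (suc zero))

  lower : ∀ j → suc j ≡ minSize → ¬ Local G c j
  lower j 1+j≡min loc =
    let (x , size≤j) = Local⇒classSize≤ valid (proj₁ used₀) loc
    in 1+n≰n (≤-trans (≤-reflexive 1+j≡min) (≤-trans (minSize≤classSize x) size≤j))
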